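{- Let $R=\langle s,r_1,r_2,\ldots\rangle$, $\sigma$, $\mathcal T$ and $\ell$ be as in the context. Then for every integer $n\ge 0$ there exists a non-root node $v$ of $\mathcal T$ with $\ell(v)=n$, and for any two non-root nodes $v,v'$ of $\mathcal T$ with $\ell(v)=\ell(v')$ we have $\ell(\mathrm{parent}(v))=\ell(\mathrm{parent}(v'))$. Consequently there is a unique function $a:\mathbb Z\to\mathbb Z_{\ge 0}$ with $a(n)=0$ for $n<0$ and $a(\ell(v))=\ell(\mathrm{parent}(v))$ for every non-root node $v$ of $\mathcal T$.
   Context: Let $R=\langle s,r_1,r_2,\ldots\rangle$ be a sequence of nonnegative integers with $s\ge 1$. Let $\Sigma=\{\mathtt r,\mathtt 0,\mathtt 1,\mathtt 2,\ldots\}$ be the infinite alphabet consisting of a letter $\mathtt r$ together with a letter $[j]$ for each integer $j\ge 0$ (so $[0]=\mathtt 0$, $[1]=\mathtt 1$, etc.). For a letter $\mathtt x$ and $m\ge 0$, $\mathtt x^m$ denotes the word consisting of $m$ copies of $\mathtt x$. Let $\sigma:\Sigma^*\to\Sigma^*$ be the morphism (monoid homomorphism of finite words) defined by $\sigma(\mathtt r)=\mathtt r\,\mathtt 0^{s}$ and $\sigma([j])=[j+1]\,\mathtt 0^{r_{j+1}}$ for $j\ge 0$. Let $\mathcal T$ be the infinite rooted ordered tree in which each node carries a label in $\Sigma$, the root is labelled $\mathtt r$, and for each node labelled $\mathtt x$, the labels of its children read from left to right spell the word $\sigma(\mathtt x)$. The rows of $\mathcal T$ are the sets of nodes at a fixed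 depth, ordered left to right. For a node $v$, $\ell(v)$ denotes the number of nodes in the same row as $v$ lying strictly to the left of $v$. -}

module Defs where

open import Data.Nat using (ℕ; zero; suc; _+_; _<_; _<ᵇ_; _∸_)
open import Data.List using (List; []; _∷_; replicate; concatMap; length)
open import Data.Bool using (if_then_else_)

data Letter : Set where
  𝕣   : Letter
  num : ℕ → Letter

-- The morphism σ on letters.  The sequence R = ⟨s, r₁, r₂, ...⟩ is given
-- by s and a function rs : ℕ → ℕ with r_i = rs i for i ≥ 1 (rs 0 unused).
σ : ℕ → (ℕ → ℕ) → Letter → List Letter
σ s rs 𝕣       = 𝕣 ∷ replicate s (num 0)
σ s rs (num j) = num (suc j) ∷ replicate (rs (suc j)) (num 0)

σ* : ℕ → (ℕ → ℕ) → List Letter → List Letter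
σ* s rs = concatMap (σ s rs)

-- Row d of the tree 𝒯: the labels of the nodes at depth d, left to right.
-- Row 0 is the root (labelled r); row (d+1) is the concatenation of the
-- children-words σ(x) of the nodes x of row d, in order.
row : ℕ → (ℕ → ℕ) → ℕ → List Letter
row s rs zero    = 𝕣 ∷ []
row s rs (suc d) = σ* s rs (row s rs d)

-- A node of 𝒯 is determined by its depth d and its position j in row d,
-- where j < length (row d); its ℓ-value is exactly j (number of nodes of
-- the same row strictly to its left).
--
-- parentPos w j : given a row w (labels of the nodes at depth d) and a
-- position j in the next row σ*(w), the position in w of the parent of
-- that node, i.e. the index i of the block σ(w[i]) of σ*(w) containing j.
parentPos : ℕ → (ℕ → ℕ) → List Letter → ℕ → ℕ
parentPos s rs []       j = 0
parentPos s rs (x ∷ xs) j =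
  if j <ᵇ length (σ s rs x)
  then 0
  else suc (parentPos s rs xs (j ∸ length (σ s rs x)))

-- Row d of 𝒯 is a prefix of row d+1: this holds for d = 0 because σ(r) begins
-- with r, and σ* preserves prefixes.  Since σ of every letter is nonempty, the
-- first length(σ*(w)) positions of σ*(w ++ u) lie in blocks coming from w, so
-- the parent of position j is the same in every row long enough to contain j.
-- The rows grow (s ≥ 1), so every n is a position of row n+1, and a(n) may be
-- read off there.
module Submission where

open import Defs
open import Data.Nat using (ℕ; suc; _≤_; _<_)
open import Data.Integer using (ℤ; +_) renaming (_<_ to _<ℤ_)
open import Data.List using (length)
open import Data.Product using (_×_; ∃-syntax; Σ-syntax)
open import Relation.Binary.PropositionalEquality using (_≡_)

open import Data.Nat using (zero; _+_; _∸_; _<ᵇ_; _≤′_; ≤′-refl; ≤′-step; z≤n; s≤s)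
open import Data.Nat.Properties
open import Data.Integer using (-[1+_]; -<+; +<+)
open import Data.List using (List; []; _∷_; _++_; replicate)
open import Data.List.Properties using (length-++; length-replicate; concatMap-++; ++-assoc; ++-identityʳ)
open import Data.Bool using (T; true; false)
open import Data.Product using (_,_)
open import Data.Sum using (inj₁; inj₂)
open import Relation.Binary.PropositionalEquality using (refl; sym; trans; cong; subst)

module _ (s : ℕ) (rs : ℕ → ℕ) where

  row-prefix-suc : (d : ℕ) → ∃[ u ] row s rs (suc d) ≡ row s rs d ++ u
  row-prefix-suc zero    = replicate s (num 0) ++ [] , refl
  row-prefix-suc (suc d) with row-prefix-suc d
  ... | u , eq = σ* s rs u , trans (cong (σ* s rs) eq) (concatMap-++ (σ s rs) (row s rs d) u)

  row-prefix : {d d′ : ℕ} → d ≤′ d′ → ∃[ u ] row s rs d′ ≡ row s rs d ++ u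
  row-prefix {d} ≤′-refl = [] , sym (++-identityʳ (row s rs d))
  row-prefix {d} (≤′-step {d′} d≤′d′) with row-prefix d≤′d′ | row-prefix-suc d′
  ... | u , eq | v , eq′ = u ++ v , trans eq′ (trans (cong (_++ v) eq) (++-assoc (row s rs d) u v))

  parentPos-++ : (w u : List Letter) (j : ℕ) → j < length (σ* s rs w) →
    parentPos s rs (w ++ u) j ≡ parentPos s rs w j
  parentPos-++ (x ∷ w) u j j<∣σ*xw∣ with j <ᵇ length (σ s rs x) in j<ᵇ∣σx∣
  ... | true  = refl
  ... | false = cong suc (parentPos-++ w u (j ∸ ∣σx∣) j∸∣σx∣<∣σ*w∣)
    where
    ∣σx∣ = length (σ s rs x)
    ∣σx∣≤j : ∣σx∣ ≤ j
    ∣σx∣≤j = ≮⇒≥ (λ j<∣σx∣ → subst T j<ᵇ∣σx∣ (<⇒<ᵇ j<∣σx∣))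
    j∸∣σx∣<∣σ*w∣ : j ∸ ∣σx∣ < length (σ* s rs w)
    j∸∣σx∣<∣σ*w∣ = subst (j ∸ ∣σx∣ <_) (m+n∸m≡n ∣σx∣ (length (σ* s rs w)))
      (∸-monoˡ-< (subst (j <_) (length-++ (σ s rs x)) j<∣σ*xw∣) ∣σx∣≤j)

  parentPos-row-stable : {d d′ j : ℕ} → d ≤ d′ → j < length (row s rs (suc d)) →
    parentPos s rs (row s rs d′) j ≡ parentPos s rs (row s rs d) j
  parentPos-row-stable {d} {j = j} d≤d′ j<∣row₁₊d∣ with row-prefix (≤⇒≤′ d≤d′)
  ... | u , eq rewrite eq = parentPos-++ (row s rs d) u j j<∣row₁₊d∣

  parentPos-row-independent : (d d′ j : ℕ) →
    j < length (row s rs (suc d)) → j < length (row s rs (suc d′)) →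
    parentPos s rs (row s rs d) j ≡ parentPos s rs (row s rs d′) j
  parentPos-row-independent d d′ j j<∣row₁₊d∣ j<∣row₁₊d′∣ with ≤-total d d′
  ... | inj₁ d≤d′ = sym (parentPos-row-stable d≤d′ j<∣row₁₊d∣)
  ... | inj₂ d′≤d = parentPos-row-stable d′≤d j<∣row₁₊d′∣

  length-σ-positive : (x : Letter) → 1 ≤ length (σ s rs x)
  length-σ-positive 𝕣       = s≤s z≤n
  length-σ-positive (num j) = s≤s z≤n

  length-σ*-≥ : (w : List Letter) → length w ≤ length (σ* s rs w)
  length-σ*-≥ []      = z≤n
  length-σ*-≥ (x ∷ w) = subst (suc (length w) ≤_) (sym (length-++ (σ s rs x)))
    (+-mono-≤ (length-σ-positive x) (length-σ*-≥ w))

  row-head : (d : ℕ) → ∃[ t ] row s rs d ≡ 𝕣 ∷ t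
  row-head d = row-prefix (z≤′n {d})

  length-row-< : 1 ≤ s → (d : ℕ) → length (row s rs d) < length (row s rs (suc d))
  length-row-< 1≤s d with row-head d
  ... | t , eq rewrite eq = s≤s (begin
    suc (length t)                                    ≤⟨ +-monoʳ-≤ 1 (length-σ*-≥ t) ⟩
    1 + length (σ* s rs t)                            ≤⟨ +-monoˡ-≤ _ 1≤s ⟩
    s + length (σ* s rs t)                            ≡⟨ cong (_+ length (σ* s rs t)) (length-replicate s) ⟨
    length (replicate s (num 0)) + length (σ* s rs t) ≡⟨ length-++ (replicate s (num 0)) ⟨
    length (replicate s (num 0) ++ σ* s rs t)         ∎)
    where open ≤-Reasoning

  n<length-row-suc : 1 ≤ s → (n : ℕ) → n < length (row s rs (suc n))
  n<length-row-suc 1≤s zero    = ≤-trans (s≤s z≤n) (length-row-< 1≤s 0)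
  n<length-row-suc 1≤s (suc n) = ≤-trans (s≤s (n<length-row-suc 1≤s n)) (length-row-< 1≤s (suc n))

  parentℓ : ℤ → ℕ
  parentℓ (+ j)    = parentPos s rs (row s rs j) j
  parentℓ -[1+ _ ] = 0

lemma1 : (s : ℕ) → 1 ≤ s → (rs : ℕ → ℕ) →
    ((n : ℕ) → Σ[ d ∈ ℕ ] (n < length (row s rs (suc d))))
    ×
    ((d d' j : ℕ) → j < length (row s rs (suc d)) → j < length (row s rs (suc d')) →
      parentPos s rs (row s rs d) j ≡ parentPos s rs (row s rs d') j)
    ×
    (Σ[ a ∈ (ℤ → ℕ) ] (((n : ℤ) → n <ℤ + 0 → a n ≡ 0)
      × ((d j : ℕ) → j < length (row s rs (suc d)) →
          a (+ j) ≡ parentPos s rs (row s rs d) j)))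
    ×
    ((a b : ℤ → ℕ) →
      ((n : ℤ) → n <ℤ + 0 → a n ≡ 0) →
      ((d j : ℕ) → j < length (row s rs (suc d)) → a (+ j) ≡ parentPos s rs (row s rs d) j) →
      ((n : ℤ) → n <ℤ + 0 → b n ≡ 0) →
      ((d j : ℕ) → j < length (row s rs (suc d)) → b (+ j) ≡ parentPos s rs (row s rs d) j) →
      (n : ℤ) → a n ≡ b n)
lemma1 s 1≤s rs =
  (λ n → n , covered n) ,
  parentPos-row-independent s rs ,
  (parentℓ s rs , parentℓ-negative , λ d j → parentPos-row-independent s rs j d j (covered j)) ,
  unique
  where
  covered : (n : ℕ) → n < length (row s rs (suc n))
  covered = n<length-row-suc s rs 1≤s

  parentℓ-negative : (n : ℤ) → n <ℤ + 0 → parentℓ s rs n ≡ 0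
  parentℓ-negative (+ j)    (+<+ ())
  parentℓ-negative -[1+ _ ] _ = refl

  unique : (a b : ℤ → ℕ) →
    ((n : ℤ) → n <ℤ + 0 → a n ≡ 0) →
    ((d j : ℕ) → j < length (row s rs (suc d)) → a (+ j) ≡ parentPos s rs (row s rs d) j) →
    ((n : ℤ) → n <ℤ + 0 → b n ≡ 0) →
    ((d j : ℕ) → j < length (row s rs (suc d)) → b (+ j) ≡ parentPos s rs (row s rs d) j) →
    (n : ℤ) → a n ≡ b n
  unique a b a-neg a-pos b-neg b-pos (+ j)    = trans (a-pos j j (covered j)) (sym (b-pos j j (covered j)))
  unique a b a-neg a-pos b-neg b-pos -[1+ k ] = trans (a-neg _ -<+) (sym (b-neg _ -<+))
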